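{- Let $G$ be the set of integer quadruples $(a,b,c,m)\in\mathbb Z^4$ with the group law $$(a_1,b_1,c_1,m_1)(a_2,b_2,c_2,m_2)=\Big(a_1+a_2+m_1b_2,\ b_1+b_2,\ c_1+c_2+a_1b_2+\tfrac12 b_2(b_2-1)m_1,\ m_1+m_2\Big).$$ Then: (1) the map $$(a,b,c,m)\mapsto\begin{pmatrix}1&m&a&c\\0&1&b&\tfrac12 b(b-1)\\0&0&1&b\\0&0&0&1\end{pmatrix}$$ is an injective group homomorphism $G\to\mathrm{GL}(4,\mathbb Z)$, so $G$ is isomorphic to a subgroup of $\mathrm{GL}(4,\mathbb Z)$; (2) the center $Z(G)$ equals $\{(0,0,c,0):c\in\mathbb Z\}\cong\mathbb Z$; (3) $[G,G]=\{(a,0,c,0):a,c\in\mathbb Z\}\cong\mathbb Z\oplus\mathbb Z$, $[[G,G],G]=Z(G)$, $G/[G,G]\cong\mathbb Z\oplus\mathbb Z$ and $[G,G]/[[G,G],G]\cong\mathbb Z$. -}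

module Defs where

open import Data.Integer using (ℤ; +_; -_; _+_; _*_; _-_)
open import Data.Integer.DivMod using (_/_)
open import Data.Fin using (Fin; zero; suc)
open import Data.Vec using (Vec; []; _∷_; lookup)
open import Data.Nat using (ℕ)
import Data.Nat as ℕ
open import Data.Product using (Σ; ∃; ∃₂; _×_; _,_)
open import Relation.Binary.PropositionalEquality using (_≡_)

-- ½ b (b - 1)  (always an integer; exact division by 2)
tri : ℤ → ℤ
tri b = (b * (b - + 1)) / + 2

record G : Set where
  constructor ⟨_,_,_,_⟩
  field
    a b c m : ℤ
open G public

infixl 7 _∙_
_∙_ : G → G → G
⟨ a₁ , b₁ , c₁ , m₁ ⟩ ∙ ⟨ a₂ , b₂ , c₂ , m₂ ⟩ =
  ⟨ a₁ + a₂ + m₁ * b₂ , b₁ + b₂ , c₁ + c₂ + a₁ * b₂ + tri b₂ * m₁ , m₁ + m₂ ⟩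

e : G
e = ⟨ + 0 , + 0 , + 0 , + 0 ⟩

inv : G → G
inv ⟨ a , b , c , m ⟩ = ⟨ - a + m * b , - b , - c + a * b - m * tri (- b) , - m ⟩

[_,_] : G → G → G
[ x , y ] = inv x ∙ inv y ∙ x ∙ y

data Gen (S : G → Set) : G → Set where
  gen  : ∀ {x} → S x → Gen S x
  unit : Gen S e
  mul  : ∀ {x y} → Gen S x → Gen S y → Gen S (x ∙ y)
  inverse : ∀ {x} → Gen S x → Gen S (inv x)

Center : G → Set
Center z = ∀ g → z ∙ g ≡ g ∙ z

Comm : G → Set
Comm z = ∃₂ λ x y → z ≡ [ x , y ]

Derived : G → Set
Derived = Gen Comm

Comm₂ : G → Set
Comm₂ z = ∃₂ λ x g → Derived x × z ≡ [ x , g ]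

Derived₂ : G → Set
Derived₂ = Gen Comm₂

Mat : Set
Mat = Fin 4 → Fin 4 → ℤ

sumFin : (n : ℕ) → (Fin n → ℤ) → ℤ
sumFin ℕ.zero f = + 0
sumFin (ℕ.suc n) f = f zero + sumFin n (λ i → f (suc i))

_⊗_ : Mat → Mat → Mat
(M ⊗ N) i j = sumFin 4 (λ k → M i k * N k j)

Iₙ : (n : ℕ) → Fin n → Fin n → ℤ
Iₙ _ zero zero = + 1
Iₙ (ℕ.suc n) (suc i) (suc j) = Iₙ n i j
Iₙ _ zero (suc j) = + 0
Iₙ _ (suc i) zero = + 0

I₄ : Mat
I₄ = Iₙ 4

_≈M_ : Mat → Mat → Set
M ≈M N = ∀ i j → M i j ≡ N i j

IsGL : Mat → Set
IsGL M = Σ Mat λ N → (M ⊗ N) ≈M I₄ × (N ⊗ M) ≈M I₄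

toMat : G → Mat
toMat ⟨ a , b , c , m ⟩ i j = lookup (lookup rows i) j
  where
  rows : Vec (Vec ℤ 4) 4
  rows = (+ 1 ∷ m ∷ a ∷ c ∷ [])
       ∷ (+ 0 ∷ + 1 ∷ b ∷ tri b ∷ [])
       ∷ (+ 0 ∷ + 0 ∷ + 1 ∷ b ∷ [])
       ∷ (+ 0 ∷ + 0 ∷ + 0 ∷ + 1 ∷ [])
       ∷ []

_⊕_ : ℤ × ℤ → ℤ × ℤ → ℤ × ℤ
(x₁ , y₁) ⊕ (x₂ , y₂) = (x₁ + x₂ , y₁ + y₂)

{-# OPTIONS --safe #-}
-- The matrices toMat x are unipotent upper triangular, and multiplying two of them
-- reproduces the group law because ½(b₁+b₂)(b₁+b₂-1) = ½b₁(b₁-1) + ½b₂(b₂-1) + b₁b₂.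
-- The map (a,b,c,m) ↦ (b,m) is a homomorphism onto ℤ ⊕ ℤ, so every commutator lies
-- in its kernel {(a,0,c,0)}. The a-coordinate of [x,y] is m_x b_y - m_y b_x, so a
-- commutator of an element of that kernel with anything has the form (0,0,c,0), and
-- these are exactly the central elements. Conversely the commutators
-- [μ,β] = (1,0,0,0) and [α,β] = (0,0,1,0) generate {(a,0,c,0)} and {(0,0,c,0)}.
module Submission where

open import Defs
open import Data.Empty using (⊥-elim)
open import Data.Fin.Base using (zero; suc)
open import Data.Integer.Base using (ℤ; +_; +[1+_]; -[1+_]; _+_; _*_; _-_; -_)
import Data.Integer.Base as ℤ
open import Data.Integer.DivMod using (_/_; _%_; n%d<d; a≡a%n+[a/n]*n)
open import Data.Integer.Divisibility.Signed using (_∣_; divides)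
open import Data.Integer.Properties
  using (+-comm; +-identityˡ; +-identityʳ; +-inverseˡ; +-inverseʳ; *-zeroʳ;
         *-distribʳ-+; *-cancelʳ-≡; i≡j⇒i-j≡0)
open import Data.Integer.Tactic.RingSolver using (solve)
open import Data.List.Base using (List; []; _∷_)
import Data.Nat.Base as ℕ
open import Data.Product using (Σ; ∃; ∃₂; _×_; _,_)
open import Data.Vec.Base using (Vec; lookup)
import Data.Vec.Base as V
open import Function.Base using (_∘_; _∋_)
open import Function.Bundles using (_⇔_; mk⇔)
import Function.Properties.Equivalence as ⇔
open import Relation.Binary.PropositionalEquality
  using (_≡_; _≢_; refl; sym; trans; cong; cong₂; subst; module ≡-Reasoning)
open import Relation.Unary using (_⊆_)
open ≡-Reasoning

ℤ-induction : (P : ℤ → Set) → P (+ 0) →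
              (∀ i → P i → P (ℤ.suc i)) → (∀ i → P i → P (ℤ.pred i)) → ∀ i → P i
ℤ-induction P P0 Psuc Ppred (+ ℕ.zero)     = P0
ℤ-induction P P0 Psuc Ppred (+ ℕ.suc n)    = Psuc (+ n) (ℤ-induction P P0 Psuc Ppred (+ n))
ℤ-induction P P0 Psuc Ppred -[1+ ℕ.zero ]  = Ppred (+ 0) P0
ℤ-induction P P0 Psuc Ppred -[1+ ℕ.suc n ] = Ppred -[1+ n ] (ℤ-induction P P0 Psuc Ppred -[1+ n ])

1≢j*2 : ∀ j → + 1 ≢ j * + 2
1≢j*2 (+ 0)     ()
1≢j*2 +[1+ n ] ()
1≢j*2 -[1+ n ] ()

odd≢even : ∀ q k → + 1 + q * + 2 ≢ k * + 2
odd≢even q k eq = 1≢j*2 (k - q) (begin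
  + 1                        ≡⟨ solve (q ∷ []) ⟩
  (+ 1 + q * + 2) - q * + 2  ≡⟨ cong (_- q * + 2) eq ⟩
  k * + 2 - q * + 2          ≡⟨ solve (k ∷ q ∷ []) ⟩
  (k - q) * + 2              ∎)

2∣n⇒n/2*2≡n : ∀ {n} → + 2 ∣ n → n / + 2 * + 2 ≡ n
2∣n⇒n/2*2≡n {n} (divides k n≡k*2)
  with n % + 2 | n%d<d n (+ 2) | a≡a%n+[a/n]*n n (+ 2)
... | 0               | _                 | n≡0+q*2 = sym (trans n≡0+q*2 (+-identityˡ _))
... | 1               | _                 | n≡1+q*2 =
  ⊥-elim (odd≢even (n / + 2) k (trans (sym n≡1+q*2) n≡k*2))
... | ℕ.suc (ℕ.suc _) | ℕ.s≤s (ℕ.s≤s ()) | _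

2∣n*[n-1] : ∀ n → + 2 ∣ n * (n - + 1)
2∣n*[n-1] = ℤ-induction _ (divides (+ 0) refl) step-suc step-pred
  where
  step-suc : ∀ i → + 2 ∣ i * (i - + 1) → + 2 ∣ ℤ.suc i * (ℤ.suc i - + 1)
  step-suc i (divides t eq) = divides (t + i) (begin
    (+ 1 + i) * ((+ 1 + i) - + 1)  ≡⟨ solve (i ∷ []) ⟩
    i * (i - + 1) + i * + 2        ≡⟨ cong (_+ i * + 2) eq ⟩
    t * + 2 + i * + 2              ≡⟨ solve (t ∷ i ∷ []) ⟩
    (t + i) * + 2                  ∎)
  step-pred : ∀ i → + 2 ∣ i * (i - + 1) → + 2 ∣ ℤ.pred i * (ℤ.pred i - + 1)
  step-pred i (divides t eq) = divides (t - i + + 1) (begin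
    (- + 1 + i) * ((- + 1 + i) - + 1)  ≡⟨ solve (i ∷ []) ⟩
    i * (i - + 1) - (i - + 1) * + 2    ≡⟨ cong (_- (i - + 1) * + 2) eq ⟩
    t * + 2 - (i - + 1) * + 2          ≡⟨ solve (t ∷ i ∷ []) ⟩
    (t - i + + 1) * + 2                ∎)

tri*2 : ∀ b → tri b * + 2 ≡ b * (b - + 1)
tri*2 b = 2∣n⇒n/2*2≡n (2∣n*[n-1] b)

tri-unique : ∀ b {t} → t * + 2 ≡ b * (b - + 1) → tri b ≡ t
tri-unique b {t} eq = *-cancelʳ-≡ (tri b) t (+ 2) (trans (tri*2 b) (sym eq))

tri-+ : ∀ x y → tri (x + y) ≡ tri x + tri y + x * y
tri-+ x y = tri-unique (x + y) (begin
  (tri x + tri y + x * y) * + 2                ≡⟨ *-distribʳ-+ (+ 2) (tri x + tri y) (x * y) ⟩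
  (tri x + tri y) * + 2 + x * y * + 2          ≡⟨ cong (_+ x * y * + 2) (*-distribʳ-+ (+ 2) (tri x) (tri y)) ⟩
  tri x * + 2 + tri y * + 2 + x * y * + 2      ≡⟨ cong₂ (λ u v → u + v + x * y * + 2) (tri*2 x) (tri*2 y) ⟩
  x * (x - + 1) + y * (y - + 1) + x * y * + 2  ≡⟨ solve (x ∷ y ∷ []) ⟩
  (x + y) * (x + y - + 1)                      ∎)

tri-neg : ∀ b → tri (- b) ≡ tri b + b
tri-neg b = tri-unique (- b) (begin
  (tri b + b) * + 2        ≡⟨ *-distribʳ-+ (+ 2) (tri b) b ⟩
  tri b * + 2 + b * + 2    ≡⟨ cong (_+ b * + 2) (tri*2 b) ⟩
  b * (b - + 1) + b * + 2  ≡⟨ solve (b ∷ []) ⟩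
  - b * (- b - + 1)        ∎)

⟨_,_,_,_⟩-cong : ∀ {a₁ b₁ c₁ m₁ a₂ b₂ c₂ m₂} → a₁ ≡ a₂ → b₁ ≡ b₂ → c₁ ≡ c₂ → m₁ ≡ m₂ →
                 ⟨ a₁ , b₁ , c₁ , m₁ ⟩ ≡ ⟨ a₂ , b₂ , c₂ , m₂ ⟩
⟨ refl , refl , refl , refl ⟩-cong = refl

∙-inverseʳ : ∀ x → x ∙ inv x ≡ e
∙-inverseʳ ⟨ a , b , c , m ⟩ =
  ⟨ (a + (- a + m * b) + m * - b ≡ + 0) ∋ solve (a ∷ b ∷ m ∷ []) , +-inverseʳ b ,
    c-coordinate (tri (- b)) , +-inverseʳ m ⟩-cong
  where
  c-coordinate : ∀ t → c + (- c + a * b - m * t) + a * - b + t * m ≡ + 0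
  c-coordinate t = solve (a ∷ b ∷ c ∷ m ∷ t ∷ [])

∙-inverseˡ : ∀ x → inv x ∙ x ≡ e
∙-inverseˡ ⟨ a , b , c , m ⟩ =
  ⟨ ((- a + m * b) + a + - m * b ≡ + 0) ∋ solve (a ∷ b ∷ m ∷ []) , +-inverseˡ b ,
    c-coordinate , +-inverseˡ m ⟩-cong
  where
  c-identity : ∀ t → (- c + a * b - m * (t + b)) + c + (- a + m * b) * b + t * - m
                     ≡ m * (b * (b - + 1) - t * + 2)
  c-identity t = solve (a ∷ b ∷ c ∷ m ∷ t ∷ [])
  c-coordinate : (- c + a * b - m * tri (- b)) + c + (- a + m * b) * b + tri b * - m ≡ + 0
  c-coordinate = begin
    (- c + a * b - m * tri (- b)) + c + (- a + m * b) * b + tri b * - m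
      ≡⟨ cong (λ t → (- c + a * b - m * t) + c + (- a + m * b) * b + tri b * - m) (tri-neg b) ⟩
    (- c + a * b - m * (tri b + b)) + c + (- a + m * b) * b + tri b * - m
      ≡⟨ c-identity (tri b) ⟩
    m * (b * (b - + 1) - tri b * + 2)
      ≡⟨ cong (λ s → m * (b * (b - + 1) - s)) (tri*2 b) ⟩
    m * (b * (b - + 1) - b * (b - + 1))
      ≡⟨ solve (m ∷ b ∷ []) ⟩
    + 0 ∎

-- toMat ⟨ a , b , c , m ⟩ is unitriangular m a c b (tri b); freeing t = tri b turns
-- each entry of a product into a polynomial identity.
unitriangular : (m a c b t : ℤ) → Mat
unitriangular m a c b t i j = lookup (lookup rows i) j
  where
  open V using ([]; _∷_)
  rows : Vec (Vec ℤ 4) 4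
  rows = (+ 1 ∷ m   ∷ a   ∷ c   ∷ [])
       ∷ (+ 0 ∷ + 1 ∷ b   ∷ t   ∷ [])
       ∷ (+ 0 ∷ + 0 ∷ + 1 ∷ b   ∷ [])
       ∷ (+ 0 ∷ + 0 ∷ + 0 ∷ + 1 ∷ [])
       ∷ []

module _ (m₁ a₁ c₁ b₁ t₁ m₂ a₂ c₂ b₂ t₂ : ℤ) where

  private
    vars : List ℤ
    vars = m₁ ∷ a₁ ∷ c₁ ∷ b₁ ∷ t₁ ∷ m₂ ∷ a₂ ∷ c₂ ∷ b₂ ∷ t₂ ∷ []

  unitriangular-⊗ :
    (unitriangular m₁ a₁ c₁ b₁ t₁ ⊗ unitriangular m₂ a₂ c₂ b₂ t₂)
      ≈M unitriangular (m₁ + m₂) (a₁ + a₂ + m₁ * b₂) (c₁ + c₂ + a₁ * b₂ + t₂ * m₁) (b₁ + b₂) (t₁ + t₂ + b₁ * b₂)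
  unitriangular-⊗ zero zero =
    (+ 1 * + 1 + (m₁ * + 0 + (a₁ * + 0 + (c₁ * + 0 + + 0))) ≡ + 1) ∋ solve vars
  unitriangular-⊗ zero (suc zero) =
    (+ 1 * m₂ + (m₁ * + 1 + (a₁ * + 0 + (c₁ * + 0 + + 0))) ≡ m₁ + m₂) ∋ solve vars
  unitriangular-⊗ zero (suc (suc zero)) =
    (+ 1 * a₂ + (m₁ * b₂ + (a₁ * + 1 + (c₁ * + 0 + + 0))) ≡ a₁ + a₂ + m₁ * b₂) ∋ solve vars
  unitriangular-⊗ zero (suc (suc (suc zero))) =
    (+ 1 * c₂ + (m₁ * t₂ + (a₁ * b₂ + (c₁ * + 1 + + 0))) ≡ c₁ + c₂ + a₁ * b₂ + t₂ * m₁) ∋ solve vars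
  unitriangular-⊗ (suc zero) zero =
    (+ 0 * + 1 + (+ 1 * + 0 + (b₁ * + 0 + (t₁ * + 0 + + 0))) ≡ + 0) ∋ solve vars
  unitriangular-⊗ (suc zero) (suc zero) =
    (+ 0 * m₂ + (+ 1 * + 1 + (b₁ * + 0 + (t₁ * + 0 + + 0))) ≡ + 1) ∋ solve vars
  unitriangular-⊗ (suc zero) (suc (suc zero)) =
    (+ 0 * a₂ + (+ 1 * b₂ + (b₁ * + 1 + (t₁ * + 0 + + 0))) ≡ b₁ + b₂) ∋ solve vars
  unitriangular-⊗ (suc zero) (suc (suc (suc zero))) =
    (+ 0 * c₂ + (+ 1 * t₂ + (b₁ * b₂ + (t₁ * + 1 + + 0))) ≡ t₁ + t₂ + b₁ * b₂) ∋ solve vars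
  unitriangular-⊗ (suc (suc zero)) zero =
    (+ 0 * + 1 + (+ 0 * + 0 + (+ 1 * + 0 + (b₁ * + 0 + + 0))) ≡ + 0) ∋ solve vars
  unitriangular-⊗ (suc (suc zero)) (suc zero) =
    (+ 0 * m₂ + (+ 0 * + 1 + (+ 1 * + 0 + (b₁ * + 0 + + 0))) ≡ + 0) ∋ solve vars
  unitriangular-⊗ (suc (suc zero)) (suc (suc zero)) =
    (+ 0 * a₂ + (+ 0 * b₂ + (+ 1 * + 1 + (b₁ * + 0 + + 0))) ≡ + 1) ∋ solve vars
  unitriangular-⊗ (suc (suc zero)) (suc (suc (suc zero))) =
    (+ 0 * c₂ + (+ 0 * t₂ + (+ 1 * b₂ + (b₁ * + 1 + + 0))) ≡ b₁ + b₂) ∋ solve vars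
  unitriangular-⊗ (suc (suc (suc zero))) zero =
    (+ 0 * + 1 + (+ 0 * + 0 + (+ 0 * + 0 + (+ 1 * + 0 + + 0))) ≡ + 0) ∋ solve vars
  unitriangular-⊗ (suc (suc (suc zero))) (suc zero) =
    (+ 0 * m₂ + (+ 0 * + 1 + (+ 0 * + 0 + (+ 1 * + 0 + + 0))) ≡ + 0) ∋ solve vars
  unitriangular-⊗ (suc (suc (suc zero))) (suc (suc zero)) =
    (+ 0 * a₂ + (+ 0 * b₂ + (+ 0 * + 1 + (+ 1 * + 0 + + 0))) ≡ + 0) ∋ solve vars
  unitriangular-⊗ (suc (suc (suc zero))) (suc (suc (suc zero))) =
    (+ 0 * c₂ + (+ 0 * t₂ + (+ 0 * b₂ + (+ 1 * + 1 + + 0))) ≡ + 1) ∋ solve vars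

toMat-∙ : ∀ x y → toMat (x ∙ y) ≈M (toMat x ⊗ toMat y)
toMat-∙ ⟨ a₁ , b₁ , c₁ , m₁ ⟩ ⟨ a₂ , b₂ , c₂ , m₂ ⟩ i j = trans
  (cong (λ t → unitriangular (m₁ + m₂) (a₁ + a₂ + m₁ * b₂) (c₁ + c₂ + a₁ * b₂ + tri b₂ * m₁) (b₁ + b₂) t i j)
        (tri-+ b₁ b₂))
  (sym (unitriangular-⊗ m₁ a₁ c₁ b₁ (tri b₁) m₂ a₂ c₂ b₂ (tri b₂) i j))

toMat-e : toMat e ≈M I₄
toMat-e zero                   zero                   = refl
toMat-e zero                   (suc zero)             = refl
toMat-e zero                   (suc (suc zero))       = refl
toMat-e zero                   (suc (suc (suc zero))) = refl
toMat-e (suc zero)             zero                   = refl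
toMat-e (suc zero)             (suc zero)             = refl
toMat-e (suc zero)             (suc (suc zero))       = refl
toMat-e (suc zero)             (suc (suc (suc zero))) = refl
toMat-e (suc (suc zero))       zero                   = refl
toMat-e (suc (suc zero))       (suc zero)             = refl
toMat-e (suc (suc zero))       (suc (suc zero))       = refl
toMat-e (suc (suc zero))       (suc (suc (suc zero))) = refl
toMat-e (suc (suc (suc zero))) zero                   = refl
toMat-e (suc (suc (suc zero))) (suc zero)             = refl
toMat-e (suc (suc (suc zero))) (suc (suc zero))       = refl
toMat-e (suc (suc (suc zero))) (suc (suc (suc zero))) = refl

toMat-inverse : ∀ x y → x ∙ y ≡ e → (toMat x ⊗ toMat y) ≈M I₄
toMat-inverse x y xy≡e i j = begin
  (toMat x ⊗ toMat y) i j  ≡⟨ toMat-∙ x y i j ⟨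
  toMat (x ∙ y) i j        ≡⟨ cong (λ g → toMat g i j) xy≡e ⟩
  toMat e i j              ≡⟨ toMat-e i j ⟩
  I₄ i j                   ∎

toMat-isGL : ∀ x → IsGL (toMat x)
toMat-isGL x =
  toMat (inv x) , toMat-inverse x (inv x) (∙-inverseʳ x) , toMat-inverse (inv x) x (∙-inverseˡ x)

toMat-injective : ∀ x y → toMat x ≈M toMat y → x ≡ y
toMat-injective ⟨ _ , _ , _ , _ ⟩ ⟨ _ , _ , _ , _ ⟩ eq =
  ⟨ eq zero (suc (suc zero)) , eq (suc zero) (suc (suc zero)) ,
    eq zero (suc (suc (suc zero))) , eq zero (suc zero) ⟩-cong

record IsSubgroup (H : G → Set) : Set where
  field
    e∈         : H e
    ∙-closed   : ∀ {x y} → H x → H y → H (x ∙ y)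
    inv-closed : ∀ {x} → H x → H (inv x)

Gen-isSubgroup : ∀ S → IsSubgroup (Gen S)
Gen-isSubgroup S = record { e∈ = unit ; ∙-closed = mul ; inv-closed = inverse }

Gen-minimal : ∀ {S H} → IsSubgroup H → S ⊆ H → Gen S ⊆ H
Gen-minimal {S} {H} H-sub S⊆H = minimal
  where
  open IsSubgroup H-sub
  minimal : Gen S ⊆ H
  minimal (gen s)     = S⊆H s
  minimal unit        = e∈
  minimal (mul x y)   = ∙-closed (minimal x) (minimal y)
  minimal (inverse x) = inv-closed (minimal x)

-- In a group the hypotheses on φ (+ 0) and φ (- + 1) follow from the homomorphism law;
-- they are assumed so as not to need associativity of _∙_ (below they hold by refl).
image-of-ℤ⊆ : ∀ {H} → IsSubgroup H → (φ : ℤ → G) → (∀ s t → φ (s + t) ≡ φ s ∙ φ t) →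
              φ (+ 0) ≡ e → φ (- + 1) ≡ inv (φ (+ 1)) → H (φ (+ 1)) → ∀ s → H (φ s)
image-of-ℤ⊆ {H} H-sub φ φ-+ φ0≡e φ-1≡φ1⁻¹ Hφ1 = ℤ-induction (H ∘ φ)
  (subst H (sym φ0≡e) e∈)
  (λ s Hφs → subst H (sym (φ-+ (+ 1) s)) (∙-closed Hφ1 Hφs))
  (λ s Hφs → subst H (sym (φ-+ (- + 1) s)) (∙-closed (subst H (sym φ-1≡φ1⁻¹) (inv-closed Hφ1)) Hφs))
  where open IsSubgroup H-sub

α β μ : G
α = ⟨ + 1 , + 0 , + 0 , + 0 ⟩
β = ⟨ + 0 , + 1 , + 0 , + 0 ⟩
μ = ⟨ + 0 , + 0 , + 0 , + 1 ⟩

derivedElt : ℤ × ℤ → G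
derivedElt (s , t) = ⟨ s , + 0 , t , + 0 ⟩

centralElt : ℤ → G
centralElt t = derivedElt (+ 0 , t)

derivedElt-⊕ : ∀ p q → derivedElt (p ⊕ q) ≡ derivedElt p ∙ derivedElt q
derivedElt-⊕ (s₁ , t₁) (s₂ , t₂) =
  ⟨ sym (+-identityʳ (s₁ + s₂)) , refl ,
    (t₁ + t₂ ≡ t₁ + t₂ + s₁ * + 0 + + 0) ∋ solve (s₁ ∷ t₁ ∷ t₂ ∷ []) , refl ⟩-cong

derivedElt-injective : ∀ p q → derivedElt p ≡ derivedElt q → p ≡ q
derivedElt-injective (_ , _) (_ , _) eq = cong₂ _,_ (cong a eq) (cong c eq)

centralElt-+ : ∀ s t → centralElt (s + t) ≡ centralElt s ∙ centralElt t
centralElt-+ s t = derivedElt-⊕ (+ 0 , s) (+ 0 , t)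

DerivedForm : G → Set
DerivedForm z = ∃₂ λ a c → z ≡ derivedElt (a , c)

CentralForm : G → Set
CentralForm z = ∃ λ c → z ≡ centralElt c

DerivedForm-isSubgroup : IsSubgroup DerivedForm
DerivedForm-isSubgroup = record
  { e∈         = + 0 , + 0 , refl
  ; ∙-closed   = λ { (_ , _ , refl) (_ , _ , refl) → _ , _ , refl }
  ; inv-closed = λ { (_ , _ , refl) → _ , _ , refl }
  }

CentralForm-isSubgroup : IsSubgroup CentralForm
CentralForm-isSubgroup = record
  { e∈         = + 0 , refl
  ; ∙-closed   = λ { (_ , refl) (_ , refl) → _ , refl }
  ; inv-closed = λ { (_ , refl) → _ , refl }
  }

ab : G → ℤ × ℤ
ab x = b x , m x

ab-kernel⇒DerivedForm : ∀ {x} → ab x ≡ (+ 0 , + 0) → DerivedForm x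
ab-kernel⇒DerivedForm {⟨ a , _ , c , _ ⟩} refl = a , c , refl

DerivedForm⇒ab-kernel : ∀ {x} → DerivedForm x → ab x ≡ (+ 0 , + 0)
DerivedForm⇒ab-kernel (_ , _ , refl) = refl

ab-commutator : ∀ x y → ab [ x , y ] ≡ (+ 0 , + 0)
ab-commutator x y = cong₂ _,_ (vanishes (b x) (b y)) (vanishes (m x) (m y))
  where
  vanishes : ∀ u v → - u + - v + u + v ≡ + 0
  vanishes u v = solve (u ∷ v ∷ [])

a-commutator : ∀ x y → a [ x , y ] ≡ m x * b y - m y * b x
a-commutator ⟨ a₁ , b₁ , _ , m₁ ⟩ ⟨ a₂ , b₂ , _ , m₂ ⟩ = begin
  (- a₁ + m₁ * b₁) + (- a₂ + m₂ * b₂) + - m₁ * - b₂ + a₁ + (- m₁ + - m₂) * b₁ + a₂ + (- m₁ + - m₂ + m₁) * b₂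
    ≡⟨ solve (a₁ ∷ b₁ ∷ m₁ ∷ a₂ ∷ b₂ ∷ m₂ ∷ []) ⟩
  m₁ * b₂ - m₂ * b₁ ∎

[μ,β]≡derivedElt : [ μ , β ] ≡ derivedElt (+ 1 , + 0)
[μ,β]≡derivedElt = refl

[α,β]≡centralElt : [ α , β ] ≡ centralElt (+ 1)
[α,β]≡centralElt = refl

Derived⊆DerivedForm : Derived ⊆ DerivedForm
Derived⊆DerivedForm = Gen-minimal DerivedForm-isSubgroup
  λ { (x , y , refl) → ab-kernel⇒DerivedForm (ab-commutator x y) }

DerivedForm⊆Derived : DerivedForm ⊆ Derived
DerivedForm⊆Derived (s , t , refl) = subst Derived (sym split) (mul (a-part s) (c-part t))
  where
  split : derivedElt (s , t) ≡ derivedElt (s , + 0) ∙ centralElt t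
  split = trans (cong derivedElt (cong₂ _,_ (sym (+-identityʳ s)) (sym (+-identityˡ t))))
                (derivedElt-⊕ (s , + 0) (+ 0 , t))
  a-part : ∀ s → Derived (derivedElt (s , + 0))
  a-part = image-of-ℤ⊆ (Gen-isSubgroup Comm) (λ s → derivedElt (s , + 0))
    (λ s t → derivedElt-⊕ (s , + 0) (t , + 0)) refl refl (gen (μ , β , [μ,β]≡derivedElt))
  c-part : ∀ t → Derived (centralElt t)
  c-part = image-of-ℤ⊆ (Gen-isSubgroup Comm) centralElt centralElt-+ refl refl
    (gen (α , β , [α,β]≡centralElt))

coordinates⇒CentralForm : ∀ z → a z ≡ + 0 → ab z ≡ (+ 0 , + 0) → CentralForm z
coordinates⇒CentralForm ⟨ _ , _ , c , _ ⟩ refl refl = c , refl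

derivedElt-commutator : ∀ p g → CentralForm [ derivedElt p , g ]
derivedElt-commutator p g =
  coordinates⇒CentralForm [ derivedElt p , g ] a≡0 (ab-commutator (derivedElt p) g)
  where
  a≡0 : a [ derivedElt p , g ] ≡ + 0
  a≡0 = trans (a-commutator (derivedElt p) g) (cong (λ u → + 0 - u) (*-zeroʳ (m g)))

DerivedForm-commutator : ∀ {x} g → DerivedForm x → CentralForm [ x , g ]
DerivedForm-commutator g (s , t , x≡st) =
  subst (λ y → CentralForm [ y , g ]) (sym x≡st) (derivedElt-commutator (s , t) g)

Derived₂⊆CentralForm : Derived₂ ⊆ CentralForm
Derived₂⊆CentralForm = Gen-minimal CentralForm-isSubgroup
  λ { (x , g , x∈Derived , refl) → DerivedForm-commutator g (Derived⊆DerivedForm x∈Derived) }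

CentralForm⊆Derived₂ : CentralForm ⊆ Derived₂
CentralForm⊆Derived₂ (t , refl) = image-of-ℤ⊆ (Gen-isSubgroup Comm₂) centralElt centralElt-+ refl refl
  (gen (α , β , DerivedForm⊆Derived (+ 1 , + 0 , refl) , [α,β]≡centralElt)) t

CentralForm⊆Center : CentralForm ⊆ Center
CentralForm⊆Center (c , refl) ⟨ a₂ , b₂ , c₂ , m₂ ⟩ =
  ⟨ (+ 0 + a₂ + + 0 ≡ a₂ + + 0 + m₂ * + 0) ∋ solve (a₂ ∷ m₂ ∷ []) , +-comm (+ 0) b₂ ,
    c-coordinate , +-comm (+ 0) m₂ ⟩-cong
  where
  c-coordinate : c + c₂ + + 0 * b₂ + tri b₂ * + 0 ≡ c₂ + c + a₂ * + 0 + tri (+ 0) * m₂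
  c-coordinate = begin
    c + c₂ + + 0 + tri b₂ * + 0  ≡⟨ cong (λ t → c + c₂ + + 0 + t) (*-zeroʳ (tri b₂)) ⟩
    c + c₂ + + 0 + + 0           ≡⟨ solve (c ∷ c₂ ∷ a₂ ∷ []) ⟩
    c₂ + c + a₂ * + 0 + + 0      ∎

Center⊆CentralForm : Center ⊆ CentralForm
Center⊆CentralForm {⟨ a , b , c , m ⟩} central =
  coordinates⇒CentralForm ⟨ a , b , c , m ⟩ a≡0 (cong₂ _,_ b≡0 m≡0)
  where
  m≡0 : m ≡ + 0
  m≡0 = begin
    m                                          ≡⟨ solve (a ∷ b ∷ m ∷ []) ⟩
    (a + + 0 + m * + 1) - (+ 0 + a + + 0 * b)  ≡⟨ i≡j⇒i-j≡0 (cong G.a (central β)) ⟩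
    + 0                                        ∎
  b≡0 : b ≡ + 0
  b≡0 = begin
    b                                          ≡⟨ solve (a ∷ b ∷ m ∷ []) ⟩
    (+ 0 + a + + 1 * b) - (a + + 0 + m * + 0)  ≡⟨ i≡j⇒i-j≡0 (sym (cong G.a (central μ))) ⟩
    + 0                                        ∎
  a≡0 : a ≡ + 0
  a≡0 = begin
    a
      ≡⟨ solve (a ∷ b ∷ c ∷ m ∷ []) ⟩
    (c + + 0 + a * + 1 + + 0 * m) - (+ 0 + c + + 0 * b + + 0)
      ≡⟨ cong (λ t → (c + + 0 + a * + 1 + + 0 * m) - (+ 0 + c + + 0 * b + t)) (*-zeroʳ (tri b)) ⟨
    (c + + 0 + a * + 1 + + 0 * m) - (+ 0 + c + + 0 * b + tri b * + 0)
      ≡⟨ i≡j⇒i-j≡0 (cong G.c (central β)) ⟩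
    + 0 ∎

Center⇔CentralForm : ∀ z → Center z ⇔ CentralForm z
Center⇔CentralForm z = mk⇔ Center⊆CentralForm CentralForm⊆Center

CentralForm⇔image : ∀ z → CentralForm z ⇔ ∃ λ s → centralElt s ≡ z
CentralForm⇔image z = mk⇔ (λ (s , eq) → s , sym eq) (λ (s , eq) → s , sym eq)

Derived⇔DerivedForm : ∀ z → Derived z ⇔ DerivedForm z
Derived⇔DerivedForm z = mk⇔ Derived⊆DerivedForm DerivedForm⊆Derived

DerivedForm⇔image : ∀ z → DerivedForm z ⇔ ∃ λ p → derivedElt p ≡ z
DerivedForm⇔image z = mk⇔ (λ (s , t , eq) → (s , t) , sym eq) (λ ((s , t) , eq) → s , t , sym eq)

Derived₂⇔Center : ∀ z → Derived₂ z ⇔ Center z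
Derived₂⇔Center z = mk⇔ (λ d → CentralForm⊆Center (Derived₂⊆CentralForm d))
                        (λ central → CentralForm⊆Derived₂ (Center⊆CentralForm central))

ab-surjective : ∀ p → ∃ λ x → ab x ≡ p
ab-surjective (s , t) = ⟨ + 0 , s , + 0 , t ⟩ , refl

ab-kernel⇔Derived : ∀ x → (ab x ≡ (+ 0 , + 0)) ⇔ Derived x
ab-kernel⇔Derived x = mk⇔ (λ ab≡0 → DerivedForm⊆Derived (ab-kernel⇒DerivedForm ab≡0))
                          (λ d → DerivedForm⇒ab-kernel (Derived⊆DerivedForm d))

a-coordinate : Σ G Derived → ℤ
a-coordinate (x , _) = a x

a-∙-DerivedForm : ∀ {x} y → DerivedForm x → a (x ∙ y) ≡ a x + a y
a-∙-DerivedForm y (s , _ , refl) = +-identityʳ (s + a y)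

a-coordinate-+ : ∀ x y (p : Derived x) (q : Derived y) (r : Derived (x ∙ y)) →
                 a-coordinate (x ∙ y , r) ≡ a-coordinate (x , p) + a-coordinate (y , q)
a-coordinate-+ x y p _ _ = a-∙-DerivedForm y (Derived⊆DerivedForm p)

a-coordinate-surjective : ∀ s → ∃ λ x → a-coordinate x ≡ s
a-coordinate-surjective s = (derivedElt (s , + 0) , DerivedForm⊆Derived (s , + 0 , refl)) , refl

a-coordinate-kernel⇔Derived₂ : ∀ x (p : Derived x) → (a-coordinate (x , p) ≡ + 0) ⇔ Derived₂ x
a-coordinate-kernel⇔Derived₂ x p = mk⇔
  (λ a≡0 → CentralForm⊆Derived₂
             (coordinates⇒CentralForm x a≡0 (DerivedForm⇒ab-kernel (Derived⊆DerivedForm p))))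
  (λ d → CentralForm⇒a≡0 (Derived₂⊆CentralForm d))
  where
  CentralForm⇒a≡0 : ∀ {z} → CentralForm z → a z ≡ + 0
  CentralForm⇒a≡0 (_ , refl) = refl

proposition14 :
    -- (1) toMat is an injective group homomorphism G → GL(4,ℤ)
    ((∀ x → IsGL (toMat x))
      × (∀ x y → toMat (x ∙ y) ≈M (toMat x ⊗ toMat y))
      × (∀ x y → toMat x ≈M toMat y → x ≡ y))
    -- (2) Z(G) = {(0,0,c,0)} ≅ ℤ
    × (∀ z → Center z ⇔ ∃ λ c → z ≡ ⟨ + 0 , + 0 , c , + 0 ⟩)
    × (Σ (ℤ → G) λ φ → (∀ s t → φ (s + t) ≡ φ s ∙ φ t)
          × (∀ s t → φ s ≡ φ t → s ≡ t)
          × (∀ z → Center z ⇔ ∃ λ s → φ s ≡ z))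
    -- (3) [G,G] = {(a,0,c,0)} ≅ ℤ ⊕ ℤ
    × (∀ z → Derived z ⇔ ∃₂ λ a c → z ≡ ⟨ a , + 0 , c , + 0 ⟩)
    × (Σ (ℤ × ℤ → G) λ φ → (∀ s t → φ (s ⊕ t) ≡ φ s ∙ φ t)
          × (∀ s t → φ s ≡ φ t → s ≡ t)
          × (∀ z → Derived z ⇔ ∃ λ s → φ s ≡ z))
    --     [[G,G],G] = Z(G)
    × (∀ z → Derived₂ z ⇔ Center z)
    --     G/[G,G] ≅ ℤ ⊕ ℤ : a surjective homomorphism G → ℤ ⊕ ℤ with kernel [G,G]
    × (Σ (G → ℤ × ℤ) λ ψ → (∀ x y → ψ (x ∙ y) ≡ ψ x ⊕ ψ y)
          × (∀ s → ∃ λ x → ψ x ≡ s)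
          × (∀ x → (ψ x ≡ (+ 0 , + 0)) ⇔ Derived x))
    --     [G,G]/[[G,G],G] ≅ ℤ : a surjective homomorphism [G,G] → ℤ with kernel [[G,G],G]
    × (Σ (Σ G Derived → ℤ) λ ψ
          → (∀ x y (p : Derived x) (q : Derived y) (r : Derived (x ∙ y))
               → ψ (x ∙ y , r) ≡ ψ (x , p) + ψ (y , q))
          × (∀ s → ∃ λ x → ψ x ≡ s)
          × (∀ x (p : Derived x) → (ψ (x , p) ≡ + 0) ⇔ Derived₂ x))
proposition14 =
  (toMat-isGL , toMat-∙ , toMat-injective) ,
  Center⇔CentralForm ,
  (centralElt , centralElt-+ , (λ _ _ → cong c) ,
    λ z → ⇔.trans (Center⇔CentralForm z) (CentralForm⇔image z)) ,
  Derived⇔DerivedForm ,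
  (derivedElt , derivedElt-⊕ , derivedElt-injective ,
    λ z → ⇔.trans (Derived⇔DerivedForm z) (DerivedForm⇔image z)) ,
  Derived₂⇔Center ,
  (ab , (λ _ _ → refl) , ab-surjective , ab-kernel⇔Derived) ,
  (a-coordinate , a-coordinate-+ , a-coordinate-surjective , a-coordinate-kernel⇔Derived₂)
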